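{- Let $G$ be a graph such that $C_4+G$ has no isolated vertices, and let $H=C_4+G+N_k$ (for some $k\ge 0$) be a sum graph with sum labelling $\lambda$. Let $S=\{\lambda(x)+\lambda(y) : xy \text{ an edge of the } C_4\}$. Then $|S|\ge 3$.
   Context: A graph $H=(V,E)$ is a sum graph with sum labelling $\lambda$ if $\lambda:V\to\mathbb{N}$ is injective and $E=\{xy : \exists z\in V,\ \lambda(z)=\lambda(x)+\lambda(y)\}$. $N_k$ denotes $k$ isolated vertices and $+$ denotes disjoint union; $C_4$ is the 4-cycle. -}

module Defs where

open import Data.Nat using (ℕ; _+_)
open import Data.Fin using (Fin; zero; suc)
open import Data.Sum using (_⊎_; inj₁; inj₂)
open import Data.Product using (Σ; ∃; _×_; _,_)
open import Data.Empty using (⊥)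
open import Relation.Nullary using (¬_)
open import Relation.Binary.PropositionalEquality using (_≡_)
open import Function.Bundles using (_⇔_)
open import Function.Definitions using (Injective)

record Graph (n : ℕ) : Set₁ where
  field
    Adj   : Fin n → Fin n → Set
    sym   : ∀ {x y} → Adj x y → Adj y x
    irrefl : ∀ {x} → ¬ Adj x x
open Graph public

next4 : Fin 4 → Fin 4
next4 zero = suc zero
next4 (suc zero) = suc (suc zero)
next4 (suc (suc zero)) = suc (suc (suc zero))
next4 (suc (suc (suc zero))) = zero

C4Adj : Fin 4 → Fin 4 → Set
C4Adj x y = (y ≡ next4 x) ⊎ (x ≡ next4 y)

HV : ℕ → ℕ → Set
HV n k = Fin 4 ⊎ (Fin n ⊎ Fin k)

HAdj : ∀ {n} k → Graph n → HV n k → HV n k → Set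
HAdj k G (inj₁ a) (inj₁ b) = C4Adj a b
HAdj k G (inj₂ (inj₁ a)) (inj₂ (inj₁ b)) = Adj G a b
HAdj k G _ _ = ⊥

NoIsolatedC4+G : ∀ {n} → Graph n → Set
NoIsolatedC4+G {n} G = (v : Fin 4 ⊎ Fin n) → ∃ λ w → Adj' v w
  where
  Adj' : Fin 4 ⊎ Fin n → Fin 4 ⊎ Fin n → Set
  Adj' (inj₁ a) (inj₁ b) = C4Adj a b
  Adj' (inj₂ a) (inj₂ b) = Adj G a b
  Adj' _ _ = ⊥

IsSumLabelling : {V : Set} → (V → V → Set) → (V → ℕ) → Set
IsSumLabelling {V} E l =
  Injective _≡_ _≡_ l ×
  ((x y : V) → ¬ x ≡ y → (E x y ⇔ (∃ λ z → l z ≡ l x + l y)))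

c4EdgeSum : ∀ {n k} → (HV n k → ℕ) → Fin 4 → ℕ
c4EdgeSum l i = l (inj₁ i) + l (inj₁ (next4 i))

{-# OPTIONS --safe #-}
module Submission where

-- Sums of
-- adjacent edges share a vertex, so they differ because the other endpoints do.
-- The two pairs of opposite edges cannot both have equal sums: a + b = c + d and
-- b + c = d + a add up to (a + c) + 2b = (a + c) + 2d, forcing b = d.  So either
-- a + b, b + c, c + d or b + c, c + d, d + a are three distinct sums.

open import Defs
open import Data.Nat using (ℕ; _+_; _*_; _≟_)
open import Data.Nat.Properties using (+-comm; +-cancelˡ-≡; +-cancelʳ-≡; *-cancelˡ-≡)
open import Data.Nat.Solver using (module +-*-Solver)
open import Data.Fin using (Fin)
open import Data.Fin.Patterns using (0F; 1F; 2F; 3F)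
open import Data.Sum using (inj₁)
open import Data.Sum.Properties using (inj₁-injective)
open import Data.Product using (∃; _×_; _,_)
open import Function using (_∘_)
open import Function.Definitions using (Injective)
open import Relation.Nullary using (¬_; yes; no)
open import Relation.Binary.PropositionalEquality using (_≡_; refl; trans; cong₂)
open +-*-Solver

+-cancel-shared : ∀ a b c → a + b ≡ b + c → a ≡ c
+-cancel-shared a b c e = +-cancelʳ-≡ b a c (trans e (+-comm b c))

opposite-sums-equal⇒≡ : ∀ a b c d → a + b ≡ c + d → b + c ≡ d + a → b ≡ d
opposite-sums-equal⇒≡ a b c d e₁ e₂ =
  *-cancelˡ-≡ b d 2 (+-cancelˡ-≡ (a + c) (2 * b) (2 * d) sum-of-both)
  where
  sum-of-both : (a + c) + 2 * b ≡ (a + c) + 2 * d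
  sum-of-both = trans (lhs a b c) (trans (cong₂ _+_ e₁ e₂) (rhs a c d))
    where
    lhs : ∀ a b c → (a + c) + 2 * b ≡ (a + b) + (b + c)
    lhs = solve 3 (λ a b c → (a :+ c) :+ con 2 :* b := (a :+ b) :+ (b :+ c)) refl
    rhs : ∀ a c d → (c + d) + (d + a) ≡ (a + c) + 2 * d
    rhs = solve 3 (λ a c d → (c :+ d) :+ (d :+ a) := (a :+ c) :+ con 2 :* d) refl

ThreeDistinctValues : (Fin 4 → ℕ) → Set
ThreeDistinctValues s =
  ∃ λ (i : Fin 4) → ∃ λ (j : Fin 4) → ∃ λ (m : Fin 4) →
    ¬ s i ≡ s j × ¬ s i ≡ s m × ¬ s j ≡ s m

cycleEdgeSum : (Fin 4 → ℕ) → Fin 4 → ℕ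
cycleEdgeSum f i = f i + f (next4 i)

module _ (f : Fin 4 → ℕ) (f-inj : Injective _≡_ _≡_ f) where

  private
    s : Fin 4 → ℕ
    s = cycleEdgeSum f

  s₀≢s₁ : ¬ s 0F ≡ s 1F
  s₀≢s₁ e with f-inj (+-cancel-shared (f 0F) (f 1F) (f 2F) e)
  ... | ()

  s₁≢s₂ : ¬ s 1F ≡ s 2F
  s₁≢s₂ e with f-inj (+-cancel-shared (f 1F) (f 2F) (f 3F) e)
  ... | ()

  s₂≢s₃ : ¬ s 2F ≡ s 3F
  s₂≢s₃ e with f-inj (+-cancel-shared (f 2F) (f 3F) (f 0F) e)
  ... | ()

  s₀≡s₂⇒s₁≢s₃ : s 0F ≡ s 2F → ¬ s 1F ≡ s 3F
  s₀≡s₂⇒s₁≢s₃ e e′ with f-inj (opposite-sums-equal⇒≡ (f 0F) (f 1F) (f 2F) (f 3F) e e′)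
  ... | ()

  injective⇒threeDistinctCycleEdgeSums : ThreeDistinctValues s
  injective⇒threeDistinctCycleEdgeSums with s 0F ≟ s 2F
  ... | no s₀≢s₂ = 0F , 1F , 2F , s₀≢s₁ , s₀≢s₂ , s₁≢s₂
  ... | yes s₀≡s₂ = 1F , 2F , 3F , s₁≢s₂ , s₀≡s₂⇒s₁≢s₃ s₀≡s₂ , s₂≢s₃

lemma17 : (n k : ℕ) (G : Graph n) → NoIsolatedC4+G G →
    (l : HV n k → ℕ) → IsSumLabelling (HAdj k G) l →
    ∃ λ (i : Fin 4) → ∃ λ (j : Fin 4) → ∃ λ (m : Fin 4) →
      ¬ c4EdgeSum l i ≡ c4EdgeSum l j × ¬ c4EdgeSum l i ≡ c4EdgeSum l m
        × ¬ c4EdgeSum l j ≡ c4EdgeSum l m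
lemma17 n k G _ l (l-inj , _) =
  injective⇒threeDistinctCycleEdgeSums (l ∘ inj₁) (λ e → inj₁-injective (l-inj e))
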